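{- If $G$ is a finite graph, then for every positive integer $n$, $c(G^n)\ge c(G)^n$.
   Context: $c(H)$ denotes the number of connected components of a graph $H$. $G^n$ is the direct product of $n$ copies of $G$: vertex set $V(G)^n$, with $u,v$ adjacent iff $u_iv_i\in E(G)$ for all $i$. -}

module Defs where

open import Data.Nat using (ℕ)
open import Data.Fin using (Fin)
open import Data.Bool using (Bool; true)
open import Data.Product using (Σ; ∃; _×_)
open import Function.Bundles using (_⇔_)
open import Relation.Binary.PropositionalEquality using (_≡_)
open import Relation.Binary.Construct.Closure.ReflexiveTransitive using (Star)

-- A finite (undirected) graph on the vertex set Fin m, given by a symmetric
-- Boolean adjacency relation (loops are allowed; simple graphs are a special case).
record FinGraph (m : ℕ) : Set where
  field
    adj : Fin m → Fin m → Bool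
    adj-sym : ∀ u v → adj u v ≡ adj v u

open FinGraph public

Adj : ∀ {m} → FinGraph m → Fin m → Fin m → Set
Adj G u v = adj G u v ≡ true

PowAdj : ∀ {m} → FinGraph m → (n : ℕ) → (Fin n → Fin m) → (Fin n → Fin m) → Set
PowAdj G n u v = ∀ (i : Fin n) → Adj G (u i) (v i)

Connected : ∀ {V : Set} → (V → V → Set) → V → V → Set
Connected E = Star E

-- The graph with vertex type V and adjacency E has exactly k connected
-- components: there is a surjection from V onto Fin k whose fibres are
-- exactly the connected components (i.e. the set of components is in
-- bijection with Fin k).
HasComponents : ∀ {V : Set} → (V → V → Set) → ℕ → Set
HasComponents {V} E k =
  Σ (V → Fin k) λ f →
    (∀ (j : Fin k) → ∃ λ v → f v ≡ j) ×
    (∀ (u v : V) → (f u ≡ f v) ⇔ Connected E u v)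

{-# OPTIONS --safe #-}
module Submission where

-- Fix a representative vertex of each component of G. An n-tuple of components
-- (a_1, …, a_n) gives the vertex of G^n whose coordinates are the chosen
-- representatives. A walk in G^n projects to a walk in G in every coordinate,
-- so two such vertices lie in the same component of G^n only if their tuples
-- agree. Hence c(G)^n tuples yield pairwise distinct components of G^n.

open import Defs
open import Data.Nat using (ℕ; _^_; _≤_; _≥_; zero; suc)
open import Data.Fin using (Fin; zero; suc; combine; finToFun; funToFin)
open import Data.Fin.Properties using (injective⇒≤; funToFin-finToFin)
open import Data.Product using (_,_; proj₁; proj₂)
open import Function using (_∘_)
open import Function.Bundles using (Equivalence)
open import Relation.Binary.PropositionalEquality
open import Relation.Binary.Construct.Closure.ReflexiveTransitive using (gmap)

funToFin-cong : ∀ {m n} {f g : Fin m → Fin n} → f ≗ g → funToFin f ≡ funToFin g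
funToFin-cong {zero}  _   = refl
funToFin-cong {suc m} f≗g = cong₂ combine (f≗g zero) (funToFin-cong (f≗g ∘ suc))

finToFun-injective : ∀ {m n} {x y : Fin (m ^ n)} → finToFun {m} {n} x ≗ finToFun y → x ≡ y
finToFun-injective {m} {n} {x} {y} eq = begin
  x                             ≡⟨ sym (funToFin-finToFin {n} {m} x) ⟩
  funToFin (finToFun {m} {n} x) ≡⟨ funToFin-cong eq ⟩
  funToFin (finToFun {m} {n} y) ≡⟨ funToFin-finToFin {n} {m} y ⟩
  y                             ∎
  where open ≡-Reasoning

module _ {V : Set} {E : V → V → Set} {k : ℕ} (C : HasComponents E k) where

  private
    label : V → Fin k
    label = proj₁ C

  representative : Fin k → V
  representative j = proj₁ (proj₁ (proj₂ C) j)

  label-representative : ∀ j → label (representative j) ≡ j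
  label-representative j = proj₂ (proj₁ (proj₂ C) j)

  representatives-connected⇒≡ : ∀ {i j} →
    Connected E (representative i) (representative j) → i ≡ j
  representatives-connected⇒≡ {i} {j} walk = begin
    i                        ≡⟨ sym (label-representative i) ⟩
    label (representative i) ≡⟨ Equivalence.from (proj₂ (proj₂ C) _ _) walk ⟩
    label (representative j) ≡⟨ label-representative j ⟩
    j                        ∎
    where open ≡-Reasoning

connected-coordinate : ∀ {m n} (G : FinGraph m) {u v : Fin n → Fin m} (i : Fin n) →
  Connected (PowAdj G n) u v → Connected (Adj G) (u i) (v i)
connected-coordinate G i = gmap (λ u → u i) (λ uv → uv i)

mainTheorem9 : ∀ {m : ℕ} (G : FinGraph m) (n : ℕ) → n ≥ 1 →
    ∀ (c₁ cₙ : ℕ) → HasComponents (Adj G) c₁ → HasComponents (PowAdj G n) cₙ →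
    c₁ ^ n ≤ cₙ
mainTheorem9 {m} G n _ c₁ cₙ C₁ (labelₙ , _ , labelₙ-fibres) =
  injective⇒≤ {f = labelₙ ∘ representativeTuple} injective
  where
    representativeTuple : Fin (c₁ ^ n) → Fin n → Fin m
    representativeTuple x i = representative C₁ (finToFun x i)

    injective : ∀ {x y} → labelₙ (representativeTuple x) ≡ labelₙ (representativeTuple y) → x ≡ y
    injective same = finToFun-injective λ i →
      representatives-connected⇒≡ C₁
        (connected-coordinate G i (Equivalence.to (labelₙ-fibres _ _) same))
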